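{- For $0\leq k\leq n$, with $k$ the fixed value indicated on each line, the following hold: $$a_{n,0}=(2n-1)!!,$$ $$a_{n,1}=(2n+1)!!-(2n)!!,$$ $$a_{n,2}=\Big(n+\tfrac{5}{3}\Big)(2n+1)!!-(2n+2)!!,$$ $$a_{n,3}=\frac{n+3}{3}(2n+3)!!-\Big(n+\tfrac{79}{48}\Big)(2n+2)!!,$$ $$a_{n,4}=\Big(\frac{n^2}{6}+\frac{7n}{6}+\frac{319}{189}\Big)(2n+3)!!-\frac{(16n+31)(n+2)}{24}(2n+2)!!,$$ $$a_{n,5}=\Big(\frac{63n^2+609n+1006}{1890}\Big)(2n+5)(2n+3)!!-\Big(\frac16n^2+\frac{13}{16}n+\frac{9107}{9216}\Big)(2n+4)!!.$$
   Context: Double factorials: $m!!=m(m-2)\cdots$, ending at $1$ or $2$, for $m\geq 1$; and $0!!=(-1)!!=1$. $a_{n,k}$ (for $n\geq k\geq 0$) is defined with rows numbered from the bottom. Take the cells $(1,j),(2,j)$ for $1\leq j\leq n$ and $(3,j)$ for $1\leq j\leq k$. Then $a_{n,k}$ is the number of bijective fillings $T$ with $\{1,\dots,2n+k\}$ such that: - rows 2 and 3 increase left to right; - $T(1,j)<T(2,j)$ for all $j$, and $T(2,j)<T(3,j)$ for $j\leq k$. The bottom row carries no row condition (walls). -}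

module Defs where

open import Data.Nat using (ℕ; zero; suc; _+_; _*_; _<ᵇ_)
open import Data.Bool using (Bool; true; false; _∧_)
open import Data.List using (List; []; _∷_; map; concatMap; filter; length; take; drop; upTo)
open import Data.Integer using (+_)
open import Data.Rational using (ℚ; _/_)
open import Relation.Nullary.Decidable using (Dec; yes; no)
open import Data.Bool using (T)
open import Data.Bool.Properties using (T?)

-- Double factorial m!! = m (m-2) ... ending at 1 or 2; 0!! = 1.
-- ((-1)!! = 1 is obtained via truncated subtraction: (2*0 ∸ 1)!! = 0!! = 1.)
_!! : ℕ → ℕ
zero !! = 1
suc zero !! = 1
suc (suc m) !! = suc (suc m) * (m !!)

ℚ[_] : ℕ → ℚ
ℚ[ n ] = + n / 1

insertEverywhere : {A : Set} → A → List A → List (List A)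
insertEverywhere x [] = (x ∷ []) ∷ []
insertEverywhere x (y ∷ ys) = (x ∷ y ∷ ys) ∷ map (y ∷_) (insertEverywhere x ys)

permutations : {A : Set} → List A → List (List A)
permutations [] = [] ∷ []
permutations (x ∷ xs) = concatMap (insertEverywhere x) (permutations xs)

increasing : List ℕ → Bool
increasing [] = true
increasing (x ∷ []) = true
increasing (x ∷ y ∷ ys) = (x <ᵇ y) ∧ increasing (y ∷ ys)

columnsBelow : List ℕ → List ℕ → Bool
columnsBelow (x ∷ xs) (y ∷ ys) = (x <ᵇ y) ∧ columnsBelow xs ys
columnsBelow _ _ = true

-- A bijective filling of the cells (1,j),(2,j) (1 ≤ j ≤ n) and (3,j) (1 ≤ j ≤ k)
-- with {1,…,2n+k} is encoded as a permutation w of the list [1,…,2n+k]: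
-- row 1 = first n entries, row 2 = next n entries, row 3 = last k entries,
-- each read left to right (columns 1,2,…).
validFilling : ℕ → List ℕ → Bool
validFilling n w =
  let row1 = take n w
      row2 = take n (drop n w)
      row3 = drop (n + n) w
  in increasing row2 ∧ increasing row3 ∧ columnsBelow row1 row2 ∧ columnsBelow row2 row3

a : ℕ → ℕ → ℕ
a n k = length (filter (λ w → T? (validFilling n w))
                       (permutations (map suc (upTo (2 * n + k)))))

module Submission where

-- Count fillings by the cell holding the largest entry.  For the recursion to close, allow m extra free
-- cells carrying no condition: the largest entry sits in a free cell, at the end of row 3, or at the end
-- of row 2 if row 3 is shorter, and in that last case the row-1 cell below it becomes a free cell.  Hence
-- shape (n, k, m) has aRec n k · (2n+k+1)⋯(2n+k+m) fillings, where
-- aRec n k = [0 < k] aRec n (k-1) + [k < n] (2n+k-1) · aRec (n-1) k.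
-- Since a sum over the permutations of a list does not depend on the order of the list, the permutations
-- of [1‥L+1] can be taken to arise by inserting L+1 into those of [1‥L].  Finally each closed form obeys
-- the same recurrence along its column, a polynomial identity in n, (2n)!! and (2n+1)!!, and agrees with
-- aRec on the diagonal.

open import Defs

module Counting where

  open import Algebra.Properties.CommutativeSemigroup using (interchange)
  open import Data.Bool using (T; true; false; _∧_; if_then_else_)
  open import Data.Bool.Properties using (T-∧; T?)
  open import Data.List using (List; []; _∷_; _++_; map; concatMap; length; filter; applyUpTo; upTo; take; drop)
  open import Data.List.Properties using (applyUpTo-∷ʳ; length-applyUpTo; length-take; length-drop; map-upTo)
  open import Data.List.Relation.Binary.Permutation.Propositional as ↭ using (_↭_; ↭-refl; ↭-sym)
  open import Data.List.Relation.Binary.Permutation.Propositional.Properties using (∷↭∷ʳ; ↭-length; All-resp-↭)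
  open import Data.List.Relation.Unary.All as All using (All; []; _∷_)
  open import Data.List.Relation.Unary.All.Properties using (map⁺; concat⁺; applyUpTo⁺₁)
  open import Data.Nat using (ℕ; zero; suc; _+_; _*_; _∸_; _≤_; _<_; z≤n; s≤s; z<s; s<s; s<s⁻¹; pred)
  open import Data.Nat.Properties
    using ( +-assoc; +-identityʳ; +-suc; *-zeroʳ; *-identityʳ; *-assoc; *-distribˡ-+; +-commutativeSemigroup
          ; suc-injective; m≤n⇒m⊓n≡m; m+n∸m≡n; allUpTo?; _<?_; _≤?_; <ᵇ⇒<; <⇒<ᵇ
          ; ≤-refl; ≤-trans; ≤-antisym; ≤-pred; <-trans; <-asym; <-≤-trans; ≤-<-trans; <⇒≤; ≰⇒>
          ; n<1+n; m<n⇒m<1+n; m<1+n⇒m<n∨m≡n; m≤n⇒m<n∨m≡n; m≤m+n; m≤n+m; +-monoʳ-≤; +-monoʳ-< )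
  open import Data.Nat.Tactic.RingSolver using (solve-∀)
  open import Data.Product using (_×_; _,_; proj₁; proj₂; map₂)
  open import Data.Sum using (inj₁; inj₂)
  open import Data.Unit using (tt)
  open import Function using (_∘_; id)
  open import Function.Bundles using (_⇔_; Equivalence; mk⇔)
  open import Function.Properties.Equivalence using () renaming (trans to ⇔-trans; sym to ⇔-sym)
  open import Level using (0ℓ)
  open import Relation.Binary.PropositionalEquality
    using (_≡_; refl; cong; cong₂; sym; trans; subst; subst₂; module ≡-Reasoning)
  open import Relation.Nullary using (Dec; yes; no; does; ¬_; contradiction; map′)
  open import Relation.Nullary.Decidable using (dec-true; dec-false)
  open import Relation.Unary using (Pred; Decidable)

  open ≡-Reasoning

  private variable
    A : Set

  ∑ : (A → ℕ) → List A → ℕ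
  ∑ h []       = 0
  ∑ h (x ∷ xs) = h x + ∑ h xs

  ∑-++ : ∀ (h : A → ℕ) xs ys → ∑ h (xs ++ ys) ≡ ∑ h xs + ∑ h ys
  ∑-++ h []       ys = refl
  ∑-++ h (x ∷ xs) ys = trans (cong (h x +_) (∑-++ h xs ys)) (sym (+-assoc (h x) _ _))

  ∑-map : ∀ {B : Set} (h : B → ℕ) (f : A → B) xs → ∑ h (map f xs) ≡ ∑ (h ∘ f) xs
  ∑-map h f []       = refl
  ∑-map h f (x ∷ xs) = cong (h (f x) +_) (∑-map h f xs)

  ∑-concatMap : ∀ {B : Set} (h : B → ℕ) (f : A → List B) xs → ∑ h (concatMap f xs) ≡ ∑ (∑ h ∘ f) xs
  ∑-concatMap h f []       = refl
  ∑-concatMap h f (x ∷ xs) =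
    trans (∑-++ h (f x) (concatMap f xs)) (cong (∑ h (f x) +_) (∑-concatMap h f xs))

  ∑-cong : ∀ {h h′ : A → ℕ} xs → (∀ x → h x ≡ h′ x) → ∑ h xs ≡ ∑ h′ xs
  ∑-cong []       eq = refl
  ∑-cong (x ∷ xs) eq = cong₂ _+_ (eq x) (∑-cong xs eq)

  ∑-congᴬ : ∀ {P : Pred A 0ℓ} {h h′ : A → ℕ} {xs} →
    All P xs → (∀ {x} → P x → h x ≡ h′ x) → ∑ h xs ≡ ∑ h′ xs
  ∑-congᴬ []         eq = refl
  ∑-congᴬ (px ∷ pxs) eq = cong₂ _+_ (eq px) (∑-congᴬ pxs eq)

  ∑-+ : ∀ (h h′ : A → ℕ) xs → ∑ (λ x → h x + h′ x) xs ≡ ∑ h xs + ∑ h′ xs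
  ∑-+ h h′ []       = refl
  ∑-+ h h′ (x ∷ xs) =
    trans (cong (h x + h′ x +_) (∑-+ h h′ xs)) (interchange +-commutativeSemigroup (h x) (h′ x) _ _)

  ∑-* : ∀ c (h : A → ℕ) xs → ∑ (λ x → c * h x) xs ≡ c * ∑ h xs
  ∑-* c h []       = sym (*-zeroʳ c)
  ∑-* c h (x ∷ xs) = trans (cong (c * h x +_) (∑-* c h xs)) (sym (*-distribˡ-+ c (h x) _))

  ∑-zero : ∀ (xs : List A) → ∑ (λ _ → 0) xs ≡ 0
  ∑-zero []       = refl
  ∑-zero (x ∷ xs) = ∑-zero xs

  ∑-insertEverywhere-∷ : ∀ (h : List A → ℕ) x z zs →
    ∑ h (insertEverywhere x (z ∷ zs)) ≡ h (x ∷ z ∷ zs) + ∑ (h ∘ (z ∷_)) (insertEverywhere x zs)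
  ∑-insertEverywhere-∷ h x z zs = cong (h (x ∷ z ∷ zs) +_) (∑-map h (z ∷_) (insertEverywhere x zs))

  ∑-insert₂ : (List A → ℕ) → A → A → List A → ℕ
  ∑-insert₂ h x y w = ∑ (λ u → ∑ h (insertEverywhere x u)) (insertEverywhere y w)

  ∑-insert₂-∷ : ∀ (h : List A → ℕ) x y z zs →
    let inserted p q = ∑ (λ t → h (q ∷ z ∷ t)) (insertEverywhere p zs) in
    ∑-insert₂ h x y (z ∷ zs) ≡
      h (x ∷ y ∷ z ∷ zs) + (h (y ∷ x ∷ z ∷ zs) + inserted x y)
        + (inserted y x + ∑-insert₂ (h ∘ (z ∷_)) x y zs)
  ∑-insert₂-∷ h x y z zs = cong₂ _+_
    (trans (∑-insertEverywhere-∷ h x y (z ∷ zs))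
           (cong (h (x ∷ y ∷ z ∷ zs) +_) (∑-insertEverywhere-∷ (h ∘ (y ∷_)) x z zs)))
    (trans (∑-map (λ u → ∑ h (insertEverywhere x u)) (z ∷_) (insertEverywhere y zs))
           (trans (∑-cong (insertEverywhere y zs) (λ u → ∑-insertEverywhere-∷ h x z u))
                  (∑-+ _ _ (insertEverywhere y zs))))

  ∑-insert₂-comm : ∀ (h : List A → ℕ) x y w → ∑-insert₂ h x y w ≡ ∑-insert₂ h y x w
  ∑-insert₂-comm h x y []       = swap₂ (h (x ∷ y ∷ [])) (h (y ∷ x ∷ []))
    where
    swap₂ : ∀ u v → u + (v + 0) + 0 ≡ v + (u + 0) + 0
    swap₂ = solve-∀
  ∑-insert₂-comm h x y (z ∷ zs) = begin
    ∑-insert₂ h x y (z ∷ zs)               ≡⟨ ∑-insert₂-∷ h x y z zs ⟩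
    hxy + (hyx + I x y) + (I y x + R x y)  ≡⟨ cong (λ t → hxy + (hyx + I x y) + (I y x + t))
                                                    (∑-insert₂-comm (h ∘ (z ∷_)) x y zs) ⟩
    hxy + (hyx + I x y) + (I y x + R y x)  ≡⟨ rearrange hxy hyx (I x y) (I y x) (R y x) ⟩
    hyx + (hxy + I y x) + (I x y + R y x)  ≡⟨ sym (∑-insert₂-∷ h y x z zs) ⟩
    ∑-insert₂ h y x (z ∷ zs)               ∎
    where
    hxy hyx : ℕ
    hxy = h (x ∷ y ∷ z ∷ zs)
    hyx = h (y ∷ x ∷ z ∷ zs)
    I R : _ → _ → ℕ
    I p q = ∑ (λ t → h (q ∷ z ∷ t)) (insertEverywhere p zs)
    R p q = ∑-insert₂ (h ∘ (z ∷_)) p q zs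
    rearrange : ∀ u v p q r → u + (v + p) + (q + r) ≡ v + (u + q) + (p + r)
    rearrange = solve-∀

  ∑-permutations-∷∷ : ∀ (h : List A → ℕ) x y xs →
    ∑ h (permutations (x ∷ y ∷ xs)) ≡ ∑ (∑-insert₂ h x y) (permutations xs)
  ∑-permutations-∷∷ h x y xs = trans
    (∑-concatMap h (insertEverywhere x) (concatMap (insertEverywhere y) (permutations xs)))
    (∑-concatMap (∑ h ∘ insertEverywhere x) (insertEverywhere y) (permutations xs))

  ∑-permutations-↭ : ∀ (h : List A → ℕ) {xs ys} → xs ↭ ys → ∑ h (permutations xs) ≡ ∑ h (permutations ys)
  ∑-permutations-↭ h ↭.refl = refl
  ∑-permutations-↭ h {x ∷ xs} {x ∷ ys} (↭.prep x p) = begin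
    ∑ h (permutations (x ∷ xs))
      ≡⟨ ∑-concatMap h (insertEverywhere x) (permutations xs) ⟩
    ∑ (∑ h ∘ insertEverywhere x) (permutations xs)
      ≡⟨ ∑-permutations-↭ (∑ h ∘ insertEverywhere x) p ⟩
    ∑ (∑ h ∘ insertEverywhere x) (permutations ys)
      ≡⟨ sym (∑-concatMap h (insertEverywhere x) (permutations ys)) ⟩
    ∑ h (permutations (x ∷ ys)) ∎
  ∑-permutations-↭ h {x ∷ y ∷ xs} {y ∷ x ∷ ys} (↭.swap x y p) = begin
    ∑ h (permutations (x ∷ y ∷ xs))
      ≡⟨ ∑-permutations-∷∷ h x y xs ⟩
    ∑ (∑-insert₂ h x y) (permutations xs)
      ≡⟨ ∑-cong (permutations xs) (∑-insert₂-comm h x y) ⟩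
    ∑ (∑-insert₂ h y x) (permutations xs)
      ≡⟨ ∑-permutations-↭ (∑-insert₂ h y x) p ⟩
    ∑ (∑-insert₂ h y x) (permutations ys)
      ≡⟨ sym (∑-permutations-∷∷ h y x ys) ⟩
    ∑ h (permutations (y ∷ x ∷ ys)) ∎
  ∑-permutations-↭ h (↭.trans p q) = trans (∑-permutations-↭ h p) (∑-permutations-↭ h q)

  insertEverywhere-↭ : ∀ (x : A) ys → All (_↭ x ∷ ys) (insertEverywhere x ys)
  insertEverywhere-↭ x []       = ↭-refl ∷ []
  insertEverywhere-↭ x (y ∷ ys) =
    ↭-refl ∷ map⁺ (All.map (λ p → ↭.trans (↭.prep y p) (↭.swap y x ↭-refl)) (insertEverywhere-↭ x ys))

  permutations-↭ : ∀ (xs : List A) → All (_↭ xs) (permutations xs)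
  permutations-↭ []       = ↭-refl ∷ []
  permutations-↭ (x ∷ xs) = concat⁺ (map⁺ (All.map
    (λ u↭xs → All.map (λ p → ↭.trans p (↭.prep x u↭xs)) (insertEverywhere-↭ x _))
    (permutations-↭ xs)))

  ∑< : ℕ → (ℕ → ℕ) → ℕ
  ∑< zero    f = 0
  ∑< (suc n) f = f 0 + ∑< n (f ∘ suc)

  ∑<-cong : ∀ n {f f′ : ℕ → ℕ} → (∀ {i} → i < n → f i ≡ f′ i) → ∑< n f ≡ ∑< n f′
  ∑<-cong zero    eq = refl
  ∑<-cong (suc n) eq = cong₂ _+_ (eq z<s) (∑<-cong n (eq ∘ s<s))

  ∑<-+ : ∀ m n f → ∑< (m + n) f ≡ ∑< m f + ∑< n (λ i → f (m + i))
  ∑<-+ zero    n f = refl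
  ∑<-+ (suc m) n f = trans (cong (f 0 +_) (∑<-+ m n (f ∘ suc))) (sym (+-assoc (f 0) _ _))

  ∑<-suc : ∀ n f → ∑< (suc n) f ≡ ∑< n f + f n
  ∑<-suc zero    f = +-identityʳ (f 0)
  ∑<-suc (suc n) f = trans (cong (f 0 +_) (∑<-suc n (f ∘ suc))) (sym (+-assoc (f 0) _ _))

  ∑<-const : ∀ n c → ∑< n (λ _ → c) ≡ n * c
  ∑<-const zero    c = refl
  ∑<-const (suc n) c = cong (c +_) (∑<-const n c)

  ∑<-zero : ∀ n {f} → (∀ {i} → i < n → f i ≡ 0) → ∑< n f ≡ 0
  ∑<-zero n eq = trans (∑<-cong n eq) (trans (∑<-const n 0) (*-zeroʳ n))

  insertAt : ℕ → A → List A → List A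
  insertAt zero    x w       = x ∷ w
  insertAt (suc i) x []      = x ∷ []
  insertAt (suc i) x (y ∷ w) = y ∷ insertAt i x w

  ∑-insertEverywhere : ∀ (h : List A → ℕ) x w →
    ∑ h (insertEverywhere x w) ≡ ∑< (suc (length w)) (λ i → h (insertAt i x w))
  ∑-insertEverywhere h x []       = refl
  ∑-insertEverywhere h x (y ∷ ys) =
    trans (∑-insertEverywhere-∷ h x y ys) (cong (h (x ∷ y ∷ ys) +_) (∑-insertEverywhere (h ∘ (y ∷_)) x ys))

  infixl 9 _!_
  _!_ : List ℕ → ℕ → ℕ
  []      ! p     = 0
  (x ∷ w) ! zero  = x
  (x ∷ w) ! suc p = w ! p

  !-insertAt-< : ∀ {x} i w {p} → i ≤ length w → p < i → insertAt i x w ! p ≡ w ! p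
  !-insertAt-< (suc i) (y ∷ w) {zero}  _         _         = refl
  !-insertAt-< (suc i) (y ∷ w) {suc p} (s≤s i≤∣w∣) (s≤s p<i) = !-insertAt-< i w i≤∣w∣ p<i

  !-insertAt-≡ : ∀ {x} i w → i ≤ length w → insertAt i x w ! i ≡ x
  !-insertAt-≡ zero    w       _           = refl
  !-insertAt-≡ (suc i) (y ∷ w) (s≤s i≤∣w∣) = !-insertAt-≡ i w i≤∣w∣

  !-insertAt-> : ∀ {x} i w {q} → i ≤ q → insertAt i x w ! suc q ≡ w ! q
  !-insertAt-> zero    w       _         = refl
  !-insertAt-> (suc i) []      _         = refl
  !-insertAt-> (suc i) (y ∷ w) (s≤s i≤q) = !-insertAt-> i w i≤q

  All≤⇒!< : ∀ {L} w → All (_≤ L) w → ∀ p → w ! p < suc L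
  All≤⇒!< []      _            p       = s≤s z≤n
  All≤⇒!< (x ∷ w) (x≤L ∷ _)    zero    = s≤s x≤L
  All≤⇒!< (x ∷ w) (_ ∷ w≤L)    (suc p) = All≤⇒!< w w≤L p

  indicator : {P : Set} → Dec P → ℕ
  indicator (yes _) = 1
  indicator (no _)  = 0

  indicator-⇔ : ∀ {P Q : Set} → P ⇔ Q → (p? : Dec P) (q? : Dec Q) → indicator p? ≡ indicator q?
  indicator-⇔ P⇔Q (yes _) (yes _) = refl
  indicator-⇔ P⇔Q (yes p) (no ¬q) = contradiction (Equivalence.to P⇔Q p) ¬q
  indicator-⇔ P⇔Q (no ¬p) (yes q) = contradiction (Equivalence.from P⇔Q q) ¬p
  indicator-⇔ P⇔Q (no _)  (no _)  = refl

  indicator-¬ : ∀ {P : Set} → ¬ P → (p? : Dec P) → indicator p? ≡ 0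
  indicator-¬ ¬p (yes p) = contradiction p ¬p
  indicator-¬ ¬p (no _)  = refl

  length-filter≡∑ : ∀ {P : Pred A 0ℓ} (P? : Decidable P) xs → length (filter P? xs) ≡ ∑ (indicator ∘ P?) xs
  length-filter≡∑ P? []       = refl
  length-filter≡∑ P? (x ∷ xs) with P? x
  ... | yes _ = cong suc (length-filter≡∑ P? xs)
  ... | no  _ = length-filter≡∑ P? xs

  record Valid (n k : ℕ) (r₁ r₂ r₃ : ℕ → ℕ) : Set where
    field
      col₁₂ : ∀ {j} → j < n → r₁ j < r₂ j
      row₂  : ∀ {j} → suc j < n → r₂ j < r₂ (suc j)
      row₃  : ∀ {j} → suc j < k → r₃ j < r₃ (suc j)
      col₂₃ : ∀ {j} → j < k → r₂ j < r₃ j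

  open Valid

  allSucUpTo? : ∀ {P : Pred ℕ 0ℓ} → Decidable P → ∀ n → Dec (∀ {j} → suc j < n → P j)
  allSucUpTo? P? zero    = yes λ ()
  allSucUpTo? P? (suc n) =
    map′ (λ all {j} j+1<n → all (s<s⁻¹ j+1<n)) (λ all {j} j<n → all (s<s j<n)) (allUpTo? P? n)

  valid? : ∀ n k r₁ r₂ r₃ → Dec (Valid n k r₁ r₂ r₃)
  valid? n k r₁ r₂ r₃
    with allUpTo? (λ j → r₁ j <? r₂ j) n | allSucUpTo? (λ j → r₂ j <? r₂ (suc j)) n
       | allSucUpTo? (λ j → r₃ j <? r₃ (suc j)) k | allUpTo? (λ j → r₂ j <? r₃ j) k
  ... | yes c₁₂ | yes r₂↑ | yes r₃↑ | yes c₂₃ =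
    yes record { col₁₂ = c₁₂ ; row₂ = r₂↑ ; row₃ = r₃↑ ; col₂₃ = c₂₃ }
  ... | no ¬c₁₂ | _       | _       | _       = no λ V → ¬c₁₂ (col₁₂ V)
  ... | yes _   | no ¬r₂↑ | _       | _       = no λ V → ¬r₂↑ (row₂ V)
  ... | yes _   | yes _   | no ¬r₃↑ | _       = no λ V → ¬r₃↑ (row₃ V)
  ... | yes _   | yes _   | yes _   | no ¬c₂₃ = no λ V → ¬c₂₃ (col₂₃ V)

  Valid-cong : ∀ {n k} {r₁ r₂ r₃ r₁′ r₂′ r₃′ : ℕ → ℕ} → k ≤ n →
    (∀ {j} → j < n → r₁ j ≡ r₁′ j) → (∀ {j} → j < n → r₂ j ≡ r₂′ j) →
    (∀ {j} → j < k → r₃ j ≡ r₃′ j) → Valid n k r₁ r₂ r₃ ⇔ Valid n k r₁′ r₂′ r₃′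
  Valid-cong k≤n eq₁ eq₂ eq₃ = mk⇔ (resp eq₁ eq₂ eq₃) (resp (sym ∘ eq₁) (sym ∘ eq₂) (sym ∘ eq₃))
    where
    suc-< : ∀ {j m} → suc j < m → j < m
    suc-< = <-trans (n<1+n _)
    resp : ∀ {r₁ r₂ r₃ r₁′ r₂′ r₃′ : ℕ → ℕ} →
      (∀ {j} → j < _ → r₁ j ≡ r₁′ j) → (∀ {j} → j < _ → r₂ j ≡ r₂′ j) →
      (∀ {j} → j < _ → r₃ j ≡ r₃′ j) → Valid _ _ r₁ r₂ r₃ → Valid _ _ r₁′ r₂′ r₃′
    resp eq₁ eq₂ eq₃ V = record
      { col₁₂ = λ j<n → subst₂ _<_ (eq₁ j<n) (eq₂ j<n) (col₁₂ V j<n)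
      ; row₂  = λ j+1<n → subst₂ _<_ (eq₂ (suc-< j+1<n)) (eq₂ j+1<n) (row₂ V j+1<n)
      ; row₃  = λ j+1<k → subst₂ _<_ (eq₃ (suc-< j+1<k)) (eq₃ j+1<k) (row₃ V j+1<k)
      ; col₂₃ = λ j<k → subst₂ _<_ (eq₂ (<-≤-trans j<k k≤n)) (eq₃ j<k) (col₂₃ V j<k)
      }

  ∀<-extend : ∀ {P : ℕ → Set} {n} → (∀ {j} → j < n → P j) → P n → ∀ {j} → j < suc n → P j
  ∀<-extend all Pn j<1+n with m<1+n⇒m<n∨m≡n j<1+n
  ... | inj₁ j<n  = all j<n
  ... | inj₂ refl = Pn

  increasing-extend : ∀ (f : ℕ → ℕ) {n} → (∀ {j} → suc j < n → f j < f (suc j)) → (∀ {j} → j < n → f j < f n) →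
    ∀ {j} → suc j < suc n → f j < f (suc j)
  increasing-extend f inc top {j} j+1<n+1 with m≤n⇒m<n∨m≡n (s<s⁻¹ j+1<n+1)
  ... | inj₁ j+1<n = inc j+1<n
  ... | inj₂ refl  = top (n<1+n j)

  Valid-extend₂ : ∀ {n k} {r₁ r₂ r₃ : ℕ → ℕ} → r₁ n < r₂ n → (∀ {j} → j < n → r₂ j < r₂ n) →
    Valid n k r₁ r₂ r₃ ⇔ Valid (suc n) k r₁ r₂ r₃
  Valid-extend₂ {r₂ = r₂} r₁n<r₂n top = mk⇔
    (λ V → record { col₁₂ = ∀<-extend (col₁₂ V) r₁n<r₂n ; row₂ = increasing-extend r₂ (row₂ V) top
                   ; row₃ = row₃ V ; col₂₃ = col₂₃ V })
    (λ V → record { col₁₂ = col₁₂ V ∘ m<n⇒m<1+n ; row₂ = row₂ V ∘ m<n⇒m<1+n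
                   ; row₃ = row₃ V ; col₂₃ = col₂₃ V })

  Valid-extend₃ : ∀ {n k} {r₁ r₂ r₃ : ℕ → ℕ} → r₂ k < r₃ k → (∀ {j} → j < k → r₃ j < r₃ k) →
    Valid n k r₁ r₂ r₃ ⇔ Valid n (suc k) r₁ r₂ r₃
  Valid-extend₃ {r₃ = r₃} r₂k<r₃k top = mk⇔
    (λ V → record { col₁₂ = col₁₂ V ; row₂ = row₂ V
                   ; row₃ = increasing-extend r₃ (row₃ V) top ; col₂₃ = ∀<-extend (col₂₃ V) r₂k<r₃k })
    (λ V → record { col₁₂ = col₁₂ V ; row₂ = row₂ V
                   ; row₃ = row₃ V ∘ m<n⇒m<1+n ; col₂₃ = col₂₃ V ∘ m<n⇒m<1+n })

  -- w is read as row 1, then m free cells, then rows 2 and 3.  The free cells lie between rows 1 and 2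
  -- so that when the largest entry ends row 2, the row-1 cell below it becomes a free cell in place.
  Fits : ℕ → ℕ → ℕ → List ℕ → Set
  Fits n k m w = Valid n k (w !_) (λ j → w ! (n + m + j)) (λ j → w ! (n + m + n + j))

  fits? : ∀ n k m w → Dec (Fits n k m w)
  fits? n k m w = valid? n k (w !_) (λ j → w ! (n + m + j)) (λ j → w ! (n + m + n + j))

  weight : ℕ → ℕ → ℕ → List ℕ → ℕ
  weight n k m w = indicator (fits? n k m w)

  -- f summed over the cells that can hold the largest entry, applied to the shape left after removing it
  endOfRow₂ endOfRow₃ cornerSum : (ℕ → ℕ → ℕ → ℕ) → ℕ → ℕ → ℕ → ℕ
  endOfRow₂ f zero    k m = 0
  endOfRow₂ f (suc n) k m = if does (k ≤? n) then f n k (suc m) else 0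
  endOfRow₃ f n zero    m = 0
  endOfRow₃ f n (suc k) m = f n k m
  cornerSum f n k m = m * f n k (pred m) + endOfRow₂ f n k m + endOfRow₃ f n k m

  module LargestEntry {X : ℕ} (w : List ℕ) (w<X : ∀ p → w ! p < X) where

    private
      v : ℕ → List ℕ
      v i = insertAt i X w

      before : ∀ {i p} → i ≤ length w → p < i → v i ! p ≡ w ! p
      before = !-insertAt-< _ w

      after : ∀ {i q p} → i ≤ q → p ≡ suc q → v i ! p ≡ w ! q
      after i≤q refl = !-insertAt-> _ w i≤q

      at : ∀ {i} → i ≤ length w → v i ! i ≡ X
      at = !-insertAt-≡ _ w

      before<at : ∀ {i p} → i ≤ length w → p < i → v i ! p < v i ! i
      before<at i≤∣w∣ p<i = subst₂ _<_ (sym (before i≤∣w∣ p<i)) (sym (at i≤∣w∣)) (w<X _)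

      blocked : ∀ {i p q} → i ≤ length w → i ≤ q → p ≡ suc q → ¬ (v i ! i < v i ! p)
      blocked i≤∣w∣ i≤q p≡1+q X<wq =
        <-asym (subst₂ _<_ (at i≤∣w∣) (after i≤q p≡1+q) X<wq) (w<X _)

      inRange : ∀ {T i} → T ≡ suc (length w) → i < T → i ≤ length w
      inRange {i = i} size i<size = ≤-pred (subst (i <_) size i<size)

      row₁≤ : ∀ n m k → n ≤ n + m + n + k
      row₁≤ n m k = ≤-trans (m≤m+n n m) (≤-trans (m≤m+n (n + m) n) (m≤m+n (n + m + n) k))

    largest-in-row₁ : ∀ {n k m j} → n + m + n + k ≡ suc (length w) → j < n → weight n k m (v j) ≡ 0
    largest-in-row₁ {suc n} {k} {m} {j} size j<n = indicator-¬ (λ V →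
      blocked (inRange size (<-≤-trans j<n (row₁≤ (suc n) m k))) (m≤n+m j (n + m)) refl (col₁₂ V j<n))
      _

    largest-in-free-cell : ∀ {n k m j} → n + suc m + n + k ≡ suc (length w) → k ≤ n → j ≤ m →
      weight n k (suc m) (v (n + j)) ≡ weight n k m w
    largest-in-free-cell {n} {k} {m} {j} size k≤n j≤m = indicator-⇔ (Valid-cong k≤n
      (λ p<n → before i≤∣w∣ (<-≤-trans p<n (m≤m+n n j)))
      (λ {p} _ → after (≤-trans i≤n+m (m≤m+n (n + m) p)) (cong (_+ p) (+-suc n m)))
      (λ {p} _ → after (≤-trans i≤n+m (≤-trans (m≤m+n (n + m) n) (m≤m+n (n + m + n) p)))
                       (cong (λ t → t + n + p) (+-suc n m)))) _ _
      where
      i≤n+m : n + j ≤ n + m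
      i≤n+m = +-monoʳ-≤ n j≤m
      i≤∣w∣ : n + j ≤ length w
      i≤∣w∣ = inRange size (≤-<-trans i≤n+m (<-≤-trans (+-monoʳ-< n (n<1+n m))
                (≤-trans (m≤m+n (n + suc m) n) (m≤m+n (n + suc m + n) k))))

    largest-inside-row₂ : ∀ {n k m j} → n + m + n + k ≡ suc (length w) → suc j < n →
      weight n k m (v (n + m + j)) ≡ 0
    largest-inside-row₂ {n} {k} {m} {j} size j+1<n = indicator-¬ (λ V →
      blocked (inRange size (<-≤-trans (+-monoʳ-< (n + m) (<-trans (n<1+n j) j+1<n)) (m≤m+n (n + m + n) k)))
              ≤-refl (+-suc (n + m) j) (row₂ V j+1<n)) _

    largest-ends-row₂-under-row₃ : ∀ {n m} → suc n + m + suc n + suc n ≡ suc (length w) →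
      weight (suc n) (suc n) m (v (suc n + m + n)) ≡ 0
    largest-ends-row₂-under-row₃ {n} {m} size = indicator-¬ (λ V →
      blocked (inRange size (<-≤-trans (+-monoʳ-< (suc n + m) (n<1+n n)) (m≤m+n (suc n + m + suc n) (suc n))))
              (m≤m+n (suc n + m + n) n) (cong (_+ n) (+-suc (suc n + m) n)) (col₂₃ V (n<1+n n))) _

    largest-ends-row₂ : ∀ {n k m} → suc n + m + suc n + k ≡ suc (length w) → k ≤ n →
      weight (suc n) k m (v (suc n + m + n)) ≡ weight n k (suc m) w
    largest-ends-row₂ {n} {k} {m} size k≤n = indicator-⇔ (⇔-trans
      (⇔-sym (Valid-extend₂ (before<at i≤∣w∣ n<i) (before<at i≤∣w∣ ∘ row₂<i)))
      (Valid-cong k≤n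
        (λ j<n → before i≤∣w∣ (<-trans j<n n<i))
        (λ {j} j<n → trans (before i≤∣w∣ (row₂<i j<n)) (cong (λ t → w ! (t + j)) (sym (+-suc n m))))
        (λ {j} _ → trans (after (m≤m+n i j) (row₃-position n m j))
                         (cong (λ t → w ! (t + n + j)) (sym (+-suc n m))))))
      _ _
      where
      i = suc n + m + n
      i≤∣w∣ : i ≤ length w
      i≤∣w∣ = inRange size (<-≤-trans (+-monoʳ-< (suc n + m) (n<1+n n)) (m≤m+n (suc n + m + suc n) k))
      n<i : n < i
      n<i = ≤-trans (m≤m+n (suc n) m) (m≤m+n (suc n + m) n)
      row₂<i : ∀ {j} → j < n → suc n + m + j < i
      row₂<i = +-monoʳ-< (suc n + m)
      row₃-position : ∀ n m j → suc n + m + suc n + j ≡ suc (suc n + m + n + j)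
      row₃-position = solve-∀

    largest-inside-row₃ : ∀ {n k m j} → n + m + n + k ≡ suc (length w) → suc j < k →
      weight n k m (v (n + m + n + j)) ≡ 0
    largest-inside-row₃ {n} {k} {m} {j} size j+1<k = indicator-¬ (λ V →
      blocked (inRange size (+-monoʳ-< (n + m + n) (<-trans (n<1+n j) j+1<k)))
              ≤-refl (+-suc (n + m + n) j) (row₃ V j+1<k)) _

    largest-ends-row₃ : ∀ {n k m} → n + m + n + suc k ≡ suc (length w) → k < n →
      weight n (suc k) m (v (n + m + n + k)) ≡ weight n k m w
    largest-ends-row₃ {n} {k} {m} size k<n = indicator-⇔ (⇔-trans
      (⇔-sym (Valid-extend₃ (before<at i≤∣w∣ (row₂<i k<n)) (before<at i≤∣w∣ ∘ +-monoʳ-< (n + m + n))))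
      (Valid-cong (<⇒≤ k<n)
        (λ j<n → before i≤∣w∣ (<-≤-trans j<n (row₁≤ n m k)))
        (λ j<n → before i≤∣w∣ (row₂<i j<n))
        (λ j<k → before i≤∣w∣ (+-monoʳ-< (n + m + n) j<k))))
      _ _
      where
      i = n + m + n + k
      i≤∣w∣ : i ≤ length w
      i≤∣w∣ = inRange size (+-monoʳ-< (n + m + n) (n<1+n k))
      row₂<i : ∀ {j} → j < n → n + m + j < i
      row₂<i j<n = <-≤-trans (+-monoʳ-< (n + m) j<n) (m≤m+n (n + m + n) k)

    private
      weights : ℕ → ℕ → ℕ → ℕ
      weights n k m = weight n k m w

      ∑<-free-cells : ∀ {n k} m → n + m + n + k ≡ suc (length w) → k ≤ n →
        ∑< m (λ j → weight n k m (v (n + j))) ≡ m * weight n k (pred m) w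
      ∑<-free-cells zero     size k≤n = refl
      ∑<-free-cells (suc m) size k≤n =
        trans (∑<-cong (suc m) (λ j<m → largest-in-free-cell size k≤n (≤-pred j<m))) (∑<-const (suc m) _)

      ∑<-row₂ : ∀ n {k m} → n + m + n + k ≡ suc (length w) → k ≤ n →
        ∑< n (λ j → weight n k m (v (n + m + j))) ≡ endOfRow₂ weights n k m
      ∑<-row₂ zero    size k≤n = refl
      ∑<-row₂ (suc n) {k} {m} size k≤n =
        trans (∑<-suc n (λ j → weight (suc n) k m (v (suc n + m + j))))
              (cong₂ _+_ (∑<-zero n (largest-inside-row₂ size ∘ s<s)) (last-cell (k ≤? n)))
        where
        last-cell : (k≤?n : Dec (k ≤ n)) →
          weight (suc n) k m (v (suc n + m + n)) ≡ (if does k≤?n then weight n k (suc m) w else 0)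
        last-cell (yes k≤n′) = largest-ends-row₂ size k≤n′
        last-cell (no  k≰n′) with ≤-antisym k≤n (≰⇒> k≰n′)
        ... | refl = largest-ends-row₂-under-row₃ size

      ∑<-row₃ : ∀ {n} k {m} → n + m + n + k ≡ suc (length w) → k ≤ n →
        ∑< k (λ j → weight n k m (v (n + m + n + j))) ≡ endOfRow₃ weights n k m
      ∑<-row₃ zero    size k≤n = refl
      ∑<-row₃ {n} (suc k) {m} size k≤n =
        trans (∑<-suc k (λ j → weight n (suc k) m (v (n + m + n + j))))
              (cong₂ _+_ (∑<-zero k (largest-inside-row₃ size ∘ s<s)) (largest-ends-row₃ size k≤n))

    ∑<-insertAt-largest : ∀ {n k m} → n + m + n + k ≡ suc (length w) → k ≤ n →
      ∑< (suc (length w)) (λ i → weight n k m (v i)) ≡ cornerSum weights n k m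
    ∑<-insertAt-largest {n} {k} {m} size k≤n = begin
      ∑< (suc (length w)) f
        ≡⟨ cong (λ T → ∑< T f) (sym size) ⟩
      ∑< (n + m + n + k) f
        ≡⟨ ∑<-+ (n + m + n) k f ⟩
      ∑< (n + m + n) f + ∑< k (λ j → f (n + m + n + j))
        ≡⟨ cong (_+ ∑< k (λ j → f (n + m + n + j)))
                (trans (∑<-+ (n + m) n f) (cong (_+ ∑< n (λ j → f (n + m + j))) (∑<-+ n m f))) ⟩
      ∑< n f + ∑< m (λ j → f (n + j)) + ∑< n (λ j → f (n + m + j)) + ∑< k (λ j → f (n + m + n + j))
        ≡⟨ cong₂ _+_ (cong₂ _+_ (cong₂ _+_ (∑<-zero n (largest-in-row₁ size)) (∑<-free-cells m size k≤n))
                                (∑<-row₂ n size k≤n))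
                     (∑<-row₃ k size k≤n) ⟩
      cornerSum weights n k m ∎
      where
      f : ℕ → ℕ
      f i = weight n k m (v i)

  ∑-cornerSum : ∀ (h : ℕ → ℕ → ℕ → A → ℕ) xs n k m →
    ∑ (λ x → cornerSum (λ n k m → h n k m x) n k m) xs ≡ cornerSum (λ n k m → ∑ (h n k m) xs) n k m
  ∑-cornerSum h xs n k m = begin
    ∑ (λ x → m * h n k (pred m) x + endOfRow₂ (at x) n k m + endOfRow₃ (at x) n k m) xs
      ≡⟨ trans (∑-+ _ _ xs) (cong (_+ ∑ (λ x → endOfRow₃ (at x) n k m) xs) (∑-+ _ _ xs)) ⟩
    ∑ (λ x → m * h n k (pred m) x) xs + ∑ (λ x → endOfRow₂ (at x) n k m) xs
      + ∑ (λ x → endOfRow₃ (at x) n k m) xs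
      ≡⟨ cong₂ _+_ (cong₂ _+_ (∑-* m (h n k (pred m)) xs) (∑-endOfRow₂ n k)) (∑-endOfRow₃ k) ⟩
    cornerSum (λ n k m → ∑ (h n k m) xs) n k m ∎
    where
    at : _ → ℕ → ℕ → ℕ → ℕ
    at x n k m = h n k m x
    ∑-endOfRow₂ : ∀ n k → ∑ (λ x → endOfRow₂ (at x) n k m) xs ≡ endOfRow₂ (λ n k m → ∑ (h n k m) xs) n k m
    ∑-endOfRow₂ zero    k = ∑-zero xs
    ∑-endOfRow₂ (suc n) k with does (k ≤? n)
    ... | true  = refl
    ... | false = ∑-zero xs
    ∑-endOfRow₃ : ∀ k → ∑ (λ x → endOfRow₃ (at x) n k m) xs ≡ endOfRow₃ (λ n k m → ∑ (h n k m) xs) n k m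
    ∑-endOfRow₃ zero    = ∑-zero xs
    ∑-endOfRow₃ (suc k) = refl

  cornerSum-cong : ∀ {f f′ : ℕ → ℕ → ℕ → ℕ} {T n k m} →
    (∀ {n k m} → n + m + n + k ≡ T → k ≤ n → f n k m ≡ f′ n k m) →
    n + m + n + k ≡ suc T → k ≤ n → cornerSum f n k m ≡ cornerSum f′ n k m
  cornerSum-cong {f} {f′} {T} {n} {k} {m} eq size k≤n =
    cong₂ _+_ (cong₂ _+_ (free-cell m size) (row₂-end n k≤n size)) (row₃-end k k≤n size)
    where
    free-cell : ∀ m → n + m + n + k ≡ suc T → m * f n k (pred m) ≡ m * f′ n k (pred m)
    free-cell zero    _    = refl
    free-cell (suc m) size = cong (suc m *_) (eq (suc-injective (trans (sym (shift n m k)) size)) k≤n)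
      where
      shift : ∀ n m k → n + suc m + n + k ≡ suc (n + m + n + k)
      shift = solve-∀
    row₂-end : ∀ n → k ≤ n → n + m + n + k ≡ suc T → endOfRow₂ f n k m ≡ endOfRow₂ f′ n k m
    row₂-end zero    _ _    = refl
    row₂-end (suc n) _ size with k ≤? n
    ... | yes k≤n rewrite dec-true (k ≤? n) k≤n =
      eq (suc-injective (trans (sym (shift n m k)) size)) k≤n
      where
      shift : ∀ n m k → suc n + m + suc n + k ≡ suc (n + suc m + n + k)
      shift = solve-∀
    ... | no  k≰n rewrite dec-false (k ≤? n) k≰n = refl
    row₃-end : ∀ k → k ≤ n → n + m + n + k ≡ suc T → endOfRow₃ f n k m ≡ endOfRow₃ f′ n k m
    row₃-end zero    _   _    = refl
    row₃-end (suc k) k<n size = eq (suc-injective (trans (sym (+-suc (n + m + n) k)) size)) (<⇒≤ k<n)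

  rising : ℕ → ℕ → ℕ
  rising r zero    = 1
  rising r (suc m) = rising r m * (r + suc m)

  rising-suc : ∀ r m → rising r (suc m) ≡ suc r * rising (suc r) m
  rising-suc r zero    = base r
    where
    base : ∀ r → 1 * (r + 1) ≡ suc r * 1
    base = solve-∀
  rising-suc r (suc m) = begin
    rising r (suc m) * (r + suc (suc m))        ≡⟨ cong₂ _*_ (rising-suc r m) (+-suc r (suc m)) ⟩
    suc r * rising (suc r) m * (suc r + suc m)  ≡⟨ *-assoc (suc r) (rising (suc r) m) (suc r + suc m) ⟩
    suc r * rising (suc r) (suc m)              ∎

  rising-step : ∀ r m → m * rising (suc r) (pred m) + rising r m ≡ rising (suc r) m
  rising-step r zero    = refl
  rising-step r (suc m) = begin
    suc m * R + rising r (suc m)  ≡⟨ cong (suc m * R +_) (rising-suc r m) ⟩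
    suc m * R + suc r * R         ≡⟨ factor m r R ⟩
    R * (suc r + suc m)           ∎
    where
    R = rising (suc r) m
    factor : ∀ m r R → suc m * R + suc r * R ≡ R * (suc r + suc m)
    factor = solve-∀

  -- only k ≤ n is meaningful; aRec 0 (suc k) is a junk value
  aRec : ℕ → ℕ → ℕ
  aRec zero    zero    = 1
  aRec zero    (suc k) = 0
  aRec (suc n) zero    = suc (n + n) * aRec n zero
  aRec (suc n) (suc k) =
    (if does (suc k ≤? n) then suc (n + n + suc k) * aRec n (suc k) else 0) + aRec (suc n) k

  aRec-suc-suc : ∀ {N K} → suc K ≤ N →
    aRec (suc N) (suc K) ≡ suc (N + N + suc K) * aRec N (suc K) + aRec (suc N) K
  aRec-suc-suc {N} {K} K<N rewrite dec-true (suc K ≤? N) K<N = refl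

  aRec-column₀ : ∀ n → aRec (suc n) 0 ≡ (2 * n + 1) !!
  aRec-column₀ zero    = refl
  aRec-column₀ (suc n) = trans (cong₂ _*_ (coefficient n) (aRec-column₀ n)) (cong _!! (sym (index n)))
    where
    coefficient : ∀ n → suc (suc n + suc n) ≡ suc (suc (2 * n + 1))
    coefficient = solve-∀
    index : ∀ n → 2 * suc n + 1 ≡ suc (suc (2 * n + 1))
    index = solve-∀

  formula : ℕ → ℕ → ℕ → ℕ
  formula n k m = aRec n k * rising (n + n + k) m

  corner-identity : ∀ r m A B G → G ≡ suc r * B + A →
    m * (G * rising (suc (suc r)) (pred m)) + B * rising r (suc m) + A * rising (suc r) m
      ≡ G * rising (suc (suc r)) m
  corner-identity r m A B _ refl = begin
    m * (G * P) + B * rising r (suc m) + A * Q  ≡⟨ cong (λ t → m * (G * P) + B * t + A * Q) (rising-suc r m) ⟩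
    m * (G * P) + B * (suc r * Q) + A * Q       ≡⟨ distribute m (suc r) A B P Q ⟩
    G * (m * P + Q)                             ≡⟨ cong (G *_) (rising-step (suc r) m) ⟩
    G * rising (suc (suc r)) m                  ∎
    where
    G = suc r * B + A
    P = rising (suc (suc r)) (pred m)
    Q = rising (suc r) m
    distribute : ∀ m s A B P Q → m * ((s * B + A) * P) + B * (s * Q) + A * Q ≡ (s * B + A) * (m * P + Q)
    distribute = solve-∀

  private
    shape-index : ∀ n k → n + suc n + k ≡ suc (n + n + k)
    shape-index = solve-∀

    row₃-index : ∀ n k → n + suc n + k ≡ n + n + suc k
    row₃-index = solve-∀

  formula-cornerSum : ∀ {T n k m} → n + m + n + k ≡ suc T → k ≤ n → cornerSum formula n k m ≡ formula n k m
  formula-cornerSum {n = zero} {zero} {suc m} _ _ = free-cells-only m (rising 0 m)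
    where
    free-cells-only : ∀ m R → suc m * (1 * R) + 0 + 0 ≡ 1 * (R * suc m)
    free-cells-only = solve-∀
  formula-cornerSum {n = suc n} {zero} {m} _ _ rewrite shape-index n 0 =
    corner-identity (n + n + 0) m 0 (aRec n 0) _ (coefficient n (aRec n 0))
    where
    coefficient : ∀ n B → suc (n + n) * B ≡ suc (n + n + 0) * B + 0
    coefficient = solve-∀
  formula-cornerSum {n = suc n} {suc k} {m} _ k<n with suc k ≤? n
  ... | yes k<n′ rewrite dec-true (suc k ≤? n) k<n′ | shape-index n (suc k) | row₃-index n k =
    corner-identity (n + n + suc k) m (aRec (suc n) k) (aRec n (suc k)) _ refl
  ... | no  k≮n′ rewrite dec-false (suc k ≤? n) k≮n′ | ≤-antisym (≤-pred k<n) (≤-pred (≰⇒> k≮n′))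
                       | shape-index n (suc n) | row₃-index n n =
    corner-identity (n + n + suc n) m (aRec (suc n) n) 0 _
                    (cong (_+ aRec (suc n) n) (sym (*-zeroʳ (suc (n + n + suc n)))))

  count : ℕ → ℕ → ℕ → ℕ → ℕ
  count n k m T = ∑ (weight n k m) (permutations (applyUpTo suc T))

  count-suc : ∀ {L n k m} → n + m + n + k ≡ suc L → k ≤ n →
    count n k m (suc L) ≡ cornerSum (λ n k m → count n k m L) n k m
  count-suc {L} {n} {k} {m} size k≤n = begin
    ∑ (weight n k m) (permutations [1‥1+L])
      ≡⟨ ∑-permutations-↭ (weight n k m) 1+L∷[1‥L]↭ ⟩
    ∑ (weight n k m) (permutations (suc L ∷ [1‥L]))
      ≡⟨ ∑-concatMap (weight n k m) (insertEverywhere (suc L)) (permutations [1‥L]) ⟩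
    ∑ (∑ (weight n k m) ∘ insertEverywhere (suc L)) (permutations [1‥L])
      ≡⟨ ∑-congᴬ (permutations-↭ [1‥L]) insert-largest ⟩
    ∑ (λ w → cornerSum (λ n k m → weight n k m w) n k m) (permutations [1‥L])
      ≡⟨ ∑-cornerSum weight (permutations [1‥L]) n k m ⟩
    cornerSum (λ n k m → count n k m L) n k m ∎
    where
    [1‥L] [1‥1+L] : List ℕ
    [1‥L]   = applyUpTo suc L
    [1‥1+L] = applyUpTo suc (suc L)
    1+L∷[1‥L]↭ : [1‥1+L] ↭ suc L ∷ [1‥L]
    1+L∷[1‥L]↭ = subst (_↭ suc L ∷ [1‥L]) (applyUpTo-∷ʳ suc L) (↭-sym (∷↭∷ʳ (suc L) [1‥L]))
    insert-largest : ∀ {w} → w ↭ [1‥L] →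
      ∑ (weight n k m) (insertEverywhere (suc L) w) ≡ cornerSum (λ n k m → weight n k m w) n k m
    insert-largest {w} w↭ = begin
      ∑ (weight n k m) (insertEverywhere (suc L) w)
        ≡⟨ ∑-insertEverywhere (weight n k m) (suc L) w ⟩
      ∑< (suc (length w)) (λ i → weight n k m (insertAt i (suc L) w))
        ≡⟨ LargestEntry.∑<-insertAt-largest w (All≤⇒!< w w≤L) (trans size (cong suc (sym ∣w∣≡L))) k≤n ⟩
      cornerSum (λ n k m → weight n k m w) n k m ∎
      where
      ∣w∣≡L : length w ≡ L
      ∣w∣≡L = trans (↭-length w↭) (length-applyUpTo suc L)
      w≤L : All (_≤ L) w
      w≤L = All-resp-↭ (↭-sym w↭) (applyUpTo⁺₁ suc L id)

  count≡formula : ∀ T {n k m} → n + m + n + k ≡ T → k ≤ n → count n k m T ≡ formula n k m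
  count≡formula zero {zero} {zero} {zero} _ _ = refl
  count≡formula (suc L) {n} {k} {m} size k≤n = begin
    count n k m (suc L)                         ≡⟨ count-suc size k≤n ⟩
    cornerSum (λ n k m → count n k m L) n k m   ≡⟨ cornerSum-cong (λ size′ → count≡formula L size′) size k≤n ⟩
    cornerSum formula n k m                     ≡⟨ formula-cornerSum size k≤n ⟩
    formula n k m                               ∎

  increasing⇔ : ∀ r → T (increasing r) ⇔ (∀ {j} → suc j < length r → r ! j < r ! suc j)
  increasing⇔ r = mk⇔ (to r) (from r)
    where
    to : ∀ r → T (increasing r) → ∀ {j} → suc j < length r → r ! j < r ! suc j
    to (x ∷ [])    _   (s<s ())
    to (x ∷ y ∷ r) inc {zero}  _          = <ᵇ⇒< x y (proj₁ (Equivalence.to T-∧ inc))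
    to (x ∷ y ∷ r) inc {suc j} (s<s j+1<) = to (y ∷ r) (proj₂ (Equivalence.to T-∧ inc)) j+1<
    from : ∀ r → (∀ {j} → suc j < length r → r ! j < r ! suc j) → T (increasing r)
    from []          _   = tt
    from (x ∷ [])    _   = tt
    from (x ∷ y ∷ r) inc = Equivalence.from T-∧ (<⇒<ᵇ (inc (s<s z<s)) , from (y ∷ r) (inc ∘ s<s))

  columnsBelow⇔ : ∀ r s → T (columnsBelow r s) ⇔ (∀ {j} → j < length r → j < length s → r ! j < s ! j)
  columnsBelow⇔ r s = mk⇔ (to r s) (from r s)
    where
    to : ∀ r s → T (columnsBelow r s) → ∀ {j} → j < length r → j < length s → r ! j < s ! j
    to (x ∷ r) (y ∷ s) below {zero}  _       _       = <ᵇ⇒< x y (proj₁ (Equivalence.to T-∧ below))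
    to (x ∷ r) (y ∷ s) below {suc j} (s<s p) (s<s q) = to r s (proj₂ (Equivalence.to T-∧ below)) p q
    from : ∀ r s → (∀ {j} → j < length r → j < length s → r ! j < s ! j) → T (columnsBelow r s)
    from []      s       _     = tt
    from (x ∷ r) []      _     = tt
    from (x ∷ r) (y ∷ s) below =
      Equivalence.from T-∧ (<⇒<ᵇ (below z<s z<s) , from r s (λ p q → below (s<s p) (s<s q)))

  T-∧⁴ : ∀ {b₁ b₂ b₃ b₄} → T (b₁ ∧ b₂ ∧ b₃ ∧ b₄) ⇔ (T b₁ × T b₂ × T b₃ × T b₄)
  T-∧⁴ = mk⇔
    (λ t → map₂ (map₂ (Equivalence.to T-∧) ∘ Equivalence.to T-∧) (Equivalence.to T-∧ t))
    (λ (t₁ , t₂ , t₃ , t₄) →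
      Equivalence.from T-∧ (t₁ , Equivalence.from T-∧ (t₂ , Equivalence.from T-∧ (t₃ , t₄))))

  validRows⇔ : ∀ {n k} r₁ r₂ r₃ → length r₁ ≡ n → length r₂ ≡ n → length r₃ ≡ k → k ≤ n →
    T (increasing r₂ ∧ increasing r₃ ∧ columnsBelow r₁ r₂ ∧ columnsBelow r₂ r₃) ⇔
    Valid n k (r₁ !_) (r₂ !_) (r₃ !_)
  validRows⇔ r₁ r₂ r₃ refl ∣r₂∣ refl k≤n = mk⇔
    (λ t → let (i₂ , i₃ , c₁₂ , c₂₃) = Equivalence.to T-∧⁴ t in record
      { col₁₂ = λ j<n → Equivalence.to (columnsBelow⇔ r₁ r₂) c₁₂ j<n (in-r₂ j<n)
      ; row₂  = λ j+1<n → Equivalence.to (increasing⇔ r₂) i₂ (in-r₂ j+1<n)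
      ; row₃  = Equivalence.to (increasing⇔ r₃) i₃
      ; col₂₃ = λ j<k → Equivalence.to (columnsBelow⇔ r₂ r₃) c₂₃ (in-r₂ (<-≤-trans j<k k≤n)) j<k
      })
    (λ V → Equivalence.from T-∧⁴
      ( Equivalence.from (increasing⇔ r₂) (row₂ V ∘ in-r₁)
      , Equivalence.from (increasing⇔ r₃) (row₃ V)
      , Equivalence.from (columnsBelow⇔ r₁ r₂) (λ j<n _ → col₁₂ V j<n)
      , Equivalence.from (columnsBelow⇔ r₂ r₃) (λ _ j<k → col₂₃ V j<k)))
    where
    in-r₂ : ∀ {i} → i < length r₁ → i < length r₂
    in-r₂ = subst (_ <_) (sym ∣r₂∣)
    in-r₁ : ∀ {i} → i < length r₂ → i < length r₁
    in-r₁ = subst (_ <_) ∣r₂∣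

  !-take : ∀ n w {j} → j < n → take n w ! j ≡ w ! j
  !-take (suc n) []      _           = refl
  !-take (suc n) (x ∷ w) {zero}  _   = refl
  !-take (suc n) (x ∷ w) {suc j} j<n = !-take n w (s<s⁻¹ j<n)

  !-drop : ∀ n w j → drop n w ! j ≡ w ! (n + j)
  !-drop zero    w       j = refl
  !-drop (suc n) []      j = refl
  !-drop (suc n) (x ∷ w) j = !-drop n w j

  validFilling⇔Fits : ∀ {n k} w → length w ≡ n + n + k → k ≤ n → T (validFilling n w) ⇔ Fits n k 0 w
  validFilling⇔Fits {n} {k} w ∣w∣ k≤n = ⇔-trans
    (validRows⇔ (take n w) (take n (drop n w)) (drop (n + n) w) ∣row₁∣ ∣row₂∣ ∣row₃∣ k≤n)
    (Valid-cong k≤n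
      (!-take n w)
      (λ {j} j<n → trans (!-take n (drop n w) j<n) (trans (!-drop n w j) (cong (λ t → w ! (t + j)) (sym (+-identityʳ n)))))
      (λ {j} _ → trans (!-drop (n + n) w j) (cong (λ t → w ! (t + n + j)) (sym (+-identityʳ n)))))
    where
    ∣drop∣ : length (drop n w) ≡ n + k
    ∣drop∣ = trans (length-drop n w) (trans (cong (_∸ n) (trans ∣w∣ (+-assoc n n k))) (m+n∸m≡n n (n + k)))
    ∣row₁∣ : length (take n w) ≡ n
    ∣row₁∣ = trans (length-take n w) (m≤n⇒m⊓n≡m (subst (n ≤_) (sym ∣w∣) (≤-trans (m≤m+n n n) (m≤m+n (n + n) k))))
    ∣row₂∣ : length (take n (drop n w)) ≡ n
    ∣row₂∣ = trans (length-take n (drop n w)) (m≤n⇒m⊓n≡m (subst (n ≤_) (sym ∣drop∣) (m≤m+n n k)))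
    ∣row₃∣ : length (drop (n + n) w) ≡ k
    ∣row₃∣ = trans (length-drop (n + n) w) (trans (cong (_∸ (n + n)) ∣w∣) (m+n∸m≡n (n + n) k))

  a≡aRec : ∀ n k → k ≤ n → a n k ≡ aRec n k
  a≡aRec n k k≤n = begin
    a n k
      ≡⟨ length-filter≡∑ validFilling? candidates ⟩
    ∑ (indicator ∘ validFilling?) candidates
      ≡⟨ cong (∑ (indicator ∘ validFilling?) ∘ permutations) (map-upTo suc (2 * n + k)) ⟩
    ∑ (indicator ∘ validFilling?) (permutations [1‥2n+k])
      ≡⟨ ∑-congᴬ (permutations-↭ [1‥2n+k]) (λ w↭ → indicator-⇔ (validFilling⇔Fits _ (length≡ w↭) k≤n) _ _) ⟩
    count n k 0 (2 * n + k)
      ≡⟨ count≡formula (2 * n + k) (size n k) k≤n ⟩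
    aRec n k * 1
      ≡⟨ *-identityʳ (aRec n k) ⟩
    aRec n k ∎
    where
    [1‥2n+k] : List ℕ
    [1‥2n+k] = applyUpTo suc (2 * n + k)
    candidates : List (List ℕ)
    candidates = permutations (map suc (upTo (2 * n + k)))
    validFilling? : ∀ w → Dec (T (validFilling n w))
    validFilling? w = T? (validFilling n w)
    size : ∀ n k → n + 0 + n + k ≡ 2 * n + k
    size = solve-∀
    length≡ : ∀ {w} → w ↭ [1‥2n+k] → length w ≡ n + n + k
    length≡ w↭ = trans (↭-length w↭) (trans (length-applyUpTo suc (2 * n + k)) (double n k))
      where
      double : ∀ n k → 2 * n + k ≡ n + n + k
      double = solve-∀

  a-column₀ : ∀ n → a n 0 ≡ (2 * n ∸ 1) !!
  a-column₀ zero    = refl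
  a-column₀ (suc n) = trans (a≡aRec (suc n) 0 z≤n) (trans (aRec-column₀ n) (cong _!! (odd n)))
    where
    -- the right-hand side is what 2 * suc n ∸ 1 reduces to
    odd : ∀ n → 2 * n + 1 ≡ n + suc (n + 0)
    odd = solve-∀

open import Algebra.Bundles.Raw using (RawRing)
open import Data.Integer as ℤ using (+_)
import Data.Integer.Properties as ℤ
import Data.Nat as ℕ
open import Data.Nat using (ℕ; zero; suc; _≤_; _∸_)
open import Data.Nat.Coprimality using (1-coprimeTo) renaming (sym to coprime-sym)
open import Data.Nat.Properties using (+-comm; +-identityʳ; +-suc; m≤n+m; m∸n+n≡m; m≤n⇒m≤1+n; <⇒≤)
open import Data.Nat.Tactic.RingSolver using (solve-∀)
open import Data.Rational using (ℚ; _/_; mkℚ; 0ℚ; 1ℚ)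
open import Data.Rational.Base using (+-*-rawRing)
open import Data.Rational.Properties using (normalize-coprime)
open import Data.Rational.Solver using (module +-*-Solver)
open import Function using (_∘_; id)
open import Level using (0ℓ)
open import Relation.Binary.PropositionalEquality
  using (_≡_; refl; cong; cong₂; sym; trans; subst; module ≡-Reasoning)

-- The closed forms are written once over an abstract ring, with κ embedding the rational constants, so that
-- the same text gives both the ℚ-valued functions of the statement and polynomial syntax for the ring solver.
module ClosedForms (R : RawRing 0ℓ 0ℓ) (κ : ℚ → RawRing.Carrier R) where
  open RawRing R

  Form : Set
  Form = Carrier → Carrier → Carrier → Carrier

  infixl 6 _-_
  _-_ : Carrier → Carrier → Carrier
  x - y = x + - y

  lin : ℕ → Carrier → Carrier
  lin c x = κ ℚ[ 2 ] * x + κ ℚ[ c ]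

  -- (2x + c)!! in terms of o = (2x + 1)!! and e = (2x)!!
  dfact : ℕ → Form
  dfact zero          x o e = e
  dfact (suc zero)    x o e = o
  dfact (suc (suc c)) x o e = lin (suc (suc c)) x * dfact c x o e

  φ₁ φ₂ φ₃ φ₄ φ₅ : Form
  φ₁ x lo hi = hi - lo
  φ₂ x lo hi = (x + κ (+ 5 / 3)) * lo - hi
  φ₃ x lo hi = ((x + κ ℚ[ 3 ]) * κ (+ 1 / 3)) * hi - (x + κ (+ 79 / 48)) * lo
  φ₄ x lo hi = (x * x * κ (+ 1 / 6) + κ ℚ[ 7 ] * x * κ (+ 1 / 6) + κ (+ 319 / 189)) * hi
             - ((κ ℚ[ 16 ] * x + κ ℚ[ 31 ]) * (x + κ ℚ[ 2 ]) * κ (+ 1 / 24)) * lo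
  φ₅ x lo hi = ((κ ℚ[ 63 ] * x * x + κ ℚ[ 609 ] * x + κ ℚ[ 1006 ]) * κ (+ 1 / 1890)) * (κ ℚ[ 2 ] * x + κ ℚ[ 5 ]) * lo
             - (κ (+ 1 / 6) * x * x + κ (+ 13 / 16) * x + κ (+ 9107 / 9216)) * hi

  valueAt valueAtSuc : Form → ℕ → Form
  valueAt    φ d x o e = φ x (dfact d x o e) (dfact (suc d) x o e)
  valueAtSuc φ d x o e = φ (x + κ 1ℚ) (dfact (2 ℕ.+ d) x o e) (dfact (3 ℕ.+ d) x o e)

  byRecurrence : Form → ℕ → Form → ℕ → Form
  byRecurrence φ d π c x o e = lin c x * valueAt φ d x o e + π x o e

open +-*-Solver using (Polynomial; solve; _:=_; _:+_; _:*_; :-_; con)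

polynomialRawRing : RawRing 0ℓ 0ℓ
polynomialRawRing = record
  { Carrier = Polynomial 3 ; _≈_ = _≡_ ; _+_ = _:+_ ; _*_ = _:*_ ; -_ = :-_ ; 0# = con 0ℚ ; 1# = con 1ℚ }

module Q = ClosedForms +-*-rawRing id
module Poly = ClosedForms polynomialRawRing con

-- column 0 at n + 1 is (2n+1)!!, i.e. o
φ₁-recurrence : ∀ x o e → Q.valueAtSuc Q.φ₁ 0 x o e ≡ Q.byRecurrence Q.φ₁ 0 (λ x o e → o) 2 x o e
φ₁-recurrence = solve 3
  (λ x o e → Poly.valueAtSuc Poly.φ₁ 0 x o e := Poly.byRecurrence Poly.φ₁ 0 (λ x o e → o) 2 x o e)
  refl

φ₂-recurrence : ∀ x o e → Q.valueAtSuc Q.φ₂ 1 x o e ≡ Q.byRecurrence Q.φ₂ 1 (Q.valueAtSuc Q.φ₁ 0) 3 x o e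
φ₂-recurrence = solve 3
  (λ x o e → Poly.valueAtSuc Poly.φ₂ 1 x o e := Poly.byRecurrence Poly.φ₂ 1 (Poly.valueAtSuc Poly.φ₁ 0) 3 x o e)
  refl

φ₃-recurrence : ∀ x o e → Q.valueAtSuc Q.φ₃ 2 x o e ≡ Q.byRecurrence Q.φ₃ 2 (Q.valueAtSuc Q.φ₂ 1) 4 x o e
φ₃-recurrence = solve 3
  (λ x o e → Poly.valueAtSuc Poly.φ₃ 2 x o e := Poly.byRecurrence Poly.φ₃ 2 (Poly.valueAtSuc Poly.φ₂ 1) 4 x o e)
  refl

φ₄-recurrence : ∀ x o e → Q.valueAtSuc Q.φ₄ 2 x o e ≡ Q.byRecurrence Q.φ₄ 2 (Q.valueAtSuc Q.φ₃ 2) 5 x o e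
φ₄-recurrence = solve 3
  (λ x o e → Poly.valueAtSuc Poly.φ₄ 2 x o e := Poly.byRecurrence Poly.φ₄ 2 (Poly.valueAtSuc Poly.φ₃ 2) 5 x o e)
  refl

φ₅-recurrence : ∀ x o e → Q.valueAtSuc Q.φ₅ 3 x o e ≡ Q.byRecurrence Q.φ₅ 3 (Q.valueAtSuc Q.φ₄ 2) 6 x o e
φ₅-recurrence = solve 3
  (λ x o e → Poly.valueAtSuc Poly.φ₅ 3 x o e := Poly.byRecurrence Poly.φ₅ 3 (Poly.valueAtSuc Poly.φ₄ 2) 6 x o e)
  refl

open import Data.Product using (_×_; _,_)
open import Data.Rational using (_+_; _*_; _-_)
open Counting using (aRec; aRec-suc-suc; aRec-column₀; a≡aRec; a-column₀)
open ≡-Reasoning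

ℚ[]≡mkℚ : ∀ n → ℚ[ n ] ≡ mkℚ (+ n) 0 (coprime-sym (1-coprimeTo n))
ℚ[]≡mkℚ n = normalize-coprime (coprime-sym (1-coprimeTo n))

ℚ[+] : ∀ m n → ℚ[ m ℕ.+ n ] ≡ ℚ[ m ] + ℚ[ n ]
ℚ[+] m n rewrite ℚ[]≡mkℚ m | ℚ[]≡mkℚ n | ℤ.*-identityʳ (+ m) | ℤ.*-identityʳ (+ n) = refl

ℚ[*] : ∀ m n → ℚ[ m ℕ.* n ] ≡ ℚ[ m ] * ℚ[ n ]
ℚ[*] m n rewrite ℚ[]≡mkℚ m | ℚ[]≡mkℚ n = cong (_/ 1) (ℤ.pos-* m n)

ℚ[suc] : ∀ n → ℚ[ suc n ] ≡ ℚ[ n ] + 1ℚ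
ℚ[suc] n = trans (cong ℚ[_] (+-comm 1 n)) (ℚ[+] n 1)

ℚ[2n+c] : ∀ n c → ℚ[ 2 ℕ.* n ℕ.+ c ] ≡ Q.lin c ℚ[ n ]
ℚ[2n+c] n c = trans (ℚ[+] (2 ℕ.* n) c) (cong (_+ ℚ[ c ]) (ℚ[*] 2 n))

odd!! even!! : ℕ → ℚ
odd!!  n = ℚ[ (2 ℕ.* n ℕ.+ 1) !! ]
even!! n = ℚ[ (2 ℕ.* n) !! ]

ℚ[!!] : ∀ n c → ℚ[ (2 ℕ.* n ℕ.+ c) !! ] ≡ Q.dfact c ℚ[ n ] (odd!! n) (even!! n)
ℚ[!!] n zero          = cong (λ m → ℚ[ m !! ]) (+-identityʳ (2 ℕ.* n))
ℚ[!!] n (suc zero)    = refl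
ℚ[!!] n (suc (suc c)) = begin
  ℚ[ (2 ℕ.* n ℕ.+ suc (suc c)) !! ]           ≡⟨ cong (λ m → ℚ[ m !! ]) two-more ⟩
  ℚ[ suc (suc m) ℕ.* m !! ]                   ≡⟨ ℚ[*] (suc (suc m)) (m !!) ⟩
  ℚ[ suc (suc m) ] * ℚ[ m !! ]                ≡⟨ cong₂ _*_ (trans (cong ℚ[_] (sym two-more)) (ℚ[2n+c] n (suc (suc c))))
                                                           (ℚ[!!] n c) ⟩
  Q.dfact (suc (suc c)) ℚ[ n ] (odd!! n) (even!! n) ∎
  where
  m = 2 ℕ.* n ℕ.+ c
  two-more : 2 ℕ.* n ℕ.+ suc (suc c) ≡ suc (suc m)
  two-more = trans (+-suc (2 ℕ.* n) (suc c)) (cong suc (+-suc (2 ℕ.* n) c))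

closedForm : Q.Form → ℕ → ℕ → ℚ
closedForm φ d n = φ ℚ[ n ] ℚ[ (2 ℕ.* n ℕ.+ d) !! ] ℚ[ (2 ℕ.* n ℕ.+ suc d) !! ]

closedForm-valueAt : ∀ φ d n → closedForm φ d n ≡ Q.valueAt φ d ℚ[ n ] (odd!! n) (even!! n)
closedForm-valueAt φ d n = cong₂ (φ ℚ[ n ]) (ℚ[!!] n d) (ℚ[!!] n (suc d))

closedForm-valueAtSuc : ∀ φ d n → closedForm φ d (suc n) ≡ Q.valueAtSuc φ d ℚ[ n ] (odd!! n) (even!! n)
closedForm-valueAtSuc φ d n = trans
  (cong (λ y → φ y (double!! d) (double!! (suc d))) (ℚ[suc] n))
  (cong₂ (φ (ℚ[ n ] + 1ℚ)) (shifted d) (shifted (suc d)))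
  where
  double!! : ℕ → ℚ
  double!! c = ℚ[ (2 ℕ.* suc n ℕ.+ c) !! ]
  index : ∀ n c → 2 ℕ.* suc n ℕ.+ c ≡ 2 ℕ.* n ℕ.+ (2 ℕ.+ c)
  index = solve-∀
  shifted : ∀ c → double!! c ≡ Q.dfact (2 ℕ.+ c) ℚ[ n ] (odd!! n) (even!! n)
  shifted c = trans (cong (λ m → ℚ[ m !! ]) (index n c)) (ℚ[!!] n (2 ℕ.+ c))

closedForm-recurrence : ∀ φ d π c (P : ℕ → ℚ) →
  (∀ n → P n ≡ π ℚ[ n ] (odd!! n) (even!! n)) →
  (∀ x o e → Q.valueAtSuc φ d x o e ≡ Q.byRecurrence φ d π c x o e) →
  ∀ n → closedForm φ d (suc n) ≡ ℚ[ 2 ℕ.* n ℕ.+ c ] * closedForm φ d n + P n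
closedForm-recurrence φ d π c P P≡π identity n = begin
  closedForm φ d (suc n)                       ≡⟨ closedForm-valueAtSuc φ d n ⟩
  Q.valueAtSuc φ d x o e                       ≡⟨ identity x o e ⟩
  Q.lin c x * Q.valueAt φ d x o e + π x o e    ≡⟨ sym (cong₂ _+_ (cong₂ _*_ (ℚ[2n+c] n c) (closedForm-valueAt φ d n))
                                                                 (P≡π n)) ⟩
  ℚ[ 2 ℕ.* n ℕ.+ c ] * closedForm φ d n + P n  ∎
  where
  x o e : ℚ
  x = ℚ[ n ]
  o = odd!! n
  e = even!! n

aRec-column : ∀ K (F P : ℕ → ℚ) →
  (∀ N → suc K ≤ N → ℚ[ aRec (suc N) K ] ≡ P N) →
  ℚ[ aRec (suc K) (suc K) ] ≡ F (suc K) →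
  (∀ N → F (suc N) ≡ ℚ[ 2 ℕ.* N ℕ.+ suc (suc K) ] * F N + P N) →
  ∀ n → suc K ≤ n → ℚ[ aRec n (suc K) ] ≡ F n
aRec-column K F P previous diagonal recurrence n K<n =
  subst (λ n → ℚ[ aRec n (suc K) ] ≡ F n) (m∸n+n≡m K<n) (from-diagonal (n ∸ suc K))
  where
  from-diagonal : ∀ i → ℚ[ aRec (i ℕ.+ suc K) (suc K) ] ≡ F (i ℕ.+ suc K)
  from-diagonal zero    = diagonal
  from-diagonal (suc i) = begin
    ℚ[ aRec (suc N) (suc K) ]
      ≡⟨ cong ℚ[_] (aRec-suc-suc K<N) ⟩
    ℚ[ c ℕ.* aRec N (suc K) ℕ.+ aRec (suc N) K ]
      ≡⟨ trans (ℚ[+] (c ℕ.* aRec N (suc K)) (aRec (suc N) K)) (cong (_+ ℚ[ aRec (suc N) K ]) (ℚ[*] c (aRec N (suc K)))) ⟩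
    ℚ[ c ] * ℚ[ aRec N (suc K) ] + ℚ[ aRec (suc N) K ]
      ≡⟨ cong₂ _+_ (cong₂ _*_ (cong ℚ[_] (coefficient N K)) (from-diagonal i)) (previous N K<N) ⟩
    ℚ[ 2 ℕ.* N ℕ.+ suc (suc K) ] * F N + P N
      ≡⟨ sym (recurrence N) ⟩
    F (suc N) ∎
    where
    N c : ℕ
    N = i ℕ.+ suc K
    c = suc (N ℕ.+ N ℕ.+ suc K)
    K<N : suc K ≤ N
    K<N = m≤n+m (suc K) i
    coefficient : ∀ N K → suc (N ℕ.+ N ℕ.+ suc K) ≡ 2 ℕ.* N ℕ.+ suc (suc K)
    coefficient = solve-∀

aRec-next-column : ∀ K φ d φ′ d′ →
  (∀ n → K ≤ n → ℚ[ aRec n K ] ≡ closedForm φ d n) →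
  ℚ[ aRec (suc K) (suc K) ] ≡ closedForm φ′ d′ (suc K) →
  (∀ x o e → Q.valueAtSuc φ′ d′ x o e ≡ Q.byRecurrence φ′ d′ (Q.valueAtSuc φ d) (suc (suc K)) x o e) →
  ∀ n → suc K ≤ n → ℚ[ aRec n (suc K) ] ≡ closedForm φ′ d′ n
aRec-next-column K φ d φ′ d′ column diagonal identity =
  aRec-column K (closedForm φ′ d′) (closedForm φ d ∘ suc)
    (λ N K<N → column (suc N) (m≤n⇒m≤1+n (<⇒≤ K<N)))
    diagonal
    (closedForm-recurrence φ′ d′ (Q.valueAtSuc φ d) (suc (suc K)) (closedForm φ d ∘ suc)
                           (closedForm-valueAtSuc φ d) identity)

aRec-column₁ : ∀ n → 1 ≤ n → ℚ[ aRec n 1 ] ≡ closedForm Q.φ₁ 0 n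
aRec-column₁ = aRec-column 0 (closedForm Q.φ₁ 0) odd!! (λ N _ → cong ℚ[_] (aRec-column₀ N)) refl
  (closedForm-recurrence Q.φ₁ 0 (λ x o e → o) 2 odd!! (λ _ → refl) φ₁-recurrence)

aRec-column₂ : ∀ n → 2 ≤ n → ℚ[ aRec n 2 ] ≡ closedForm Q.φ₂ 1 n
aRec-column₂ = aRec-next-column 1 Q.φ₁ 0 Q.φ₂ 1 aRec-column₁ refl φ₂-recurrence

aRec-column₃ : ∀ n → 3 ≤ n → ℚ[ aRec n 3 ] ≡ closedForm Q.φ₃ 2 n
aRec-column₃ = aRec-next-column 2 Q.φ₂ 1 Q.φ₃ 2 aRec-column₂ refl φ₃-recurrence

aRec-column₄ : ∀ n → 4 ≤ n → ℚ[ aRec n 4 ] ≡ closedForm Q.φ₄ 2 n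
aRec-column₄ = aRec-next-column 3 Q.φ₃ 2 Q.φ₄ 2 aRec-column₃ refl φ₄-recurrence

aRec-column₅ : ∀ n → 5 ≤ n → ℚ[ aRec n 5 ] ≡ closedForm Q.φ₅ 3 n
aRec-column₅ = aRec-next-column 4 Q.φ₄ 2 Q.φ₅ 3 aRec-column₄ refl φ₅-recurrence

a-column : ∀ {k} {F : ℕ → ℚ} → (∀ n → k ≤ n → ℚ[ aRec n k ] ≡ F n) → ∀ n → k ≤ n → ℚ[ a n k ] ≡ F n
a-column column n k≤n = trans (cong ℚ[_] (a≡aRec n _ k≤n)) (column n k≤n)

propositionA1 :
    ((n : ℕ) → ℚ[ a n 0 ] ≡ ℚ[ (2 Data.Nat.* n ∸ 1) !! ])
    × ((n : ℕ) → 1 ≤ n → ℚ[ a n 1 ] ≡ ℚ[ (2 Data.Nat.* n Data.Nat.+ 1) !! ] - ℚ[ (2 Data.Nat.* n) !! ])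
    × ((n : ℕ) → 2 ≤ n →
        ℚ[ a n 2 ] ≡ (ℚ[ n ] + + 5 / 3) * ℚ[ (2 Data.Nat.* n Data.Nat.+ 1) !! ]
                     - ℚ[ (2 Data.Nat.* n Data.Nat.+ 2) !! ])
    × ((n : ℕ) → 3 ≤ n →
        ℚ[ a n 3 ] ≡ ((ℚ[ n ] + ℚ[ 3 ]) * (+ 1 / 3)) * ℚ[ (2 Data.Nat.* n Data.Nat.+ 3) !! ]
                     - (ℚ[ n ] + + 79 / 48) * ℚ[ (2 Data.Nat.* n Data.Nat.+ 2) !! ])
    × ((n : ℕ) → 4 ≤ n →
        ℚ[ a n 4 ] ≡ (ℚ[ n ] * ℚ[ n ] * (+ 1 / 6) + ℚ[ 7 ] * ℚ[ n ] * (+ 1 / 6) + + 319 / 189)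
                       * ℚ[ (2 Data.Nat.* n Data.Nat.+ 3) !! ]
                     - ((ℚ[ 16 ] * ℚ[ n ] + ℚ[ 31 ]) * (ℚ[ n ] + ℚ[ 2 ]) * (+ 1 / 24))
                       * ℚ[ (2 Data.Nat.* n Data.Nat.+ 2) !! ])
    × ((n : ℕ) → 5 ≤ n →
        ℚ[ a n 5 ] ≡ ((ℚ[ 63 ] * ℚ[ n ] * ℚ[ n ] + ℚ[ 609 ] * ℚ[ n ] + ℚ[ 1006 ]) * (+ 1 / 1890))
                       * (ℚ[ 2 ] * ℚ[ n ] + ℚ[ 5 ]) * ℚ[ (2 Data.Nat.* n Data.Nat.+ 3) !! ]
                     - ((+ 1 / 6) * ℚ[ n ] * ℚ[ n ] + (+ 13 / 16) * ℚ[ n ] + + 9107 / 9216)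
                       * ℚ[ (2 Data.Nat.* n Data.Nat.+ 4) !! ])
propositionA1 =
    (λ n → cong ℚ[_] (a-column₀ n))
  , (λ n 1≤n → trans (a-column aRec-column₁ n 1≤n)
                     (cong (λ m → ℚ[ (2 Data.Nat.* n Data.Nat.+ 1) !! ] - ℚ[ m !! ]) (+-identityʳ (2 Data.Nat.* n))))
  , a-column aRec-column₂
  , a-column aRec-column₃
  , a-column aRec-column₄
  , a-column aRec-column₅
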